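{- Let $q$ be a power of an odd prime, let $\lambda\in\mathbb{F}_q$ be a non-square, and let $f\in\mathbb{F}_q[X]$ be a permutation polynomial of $\mathbb{F}_q$. Suppose that $\mathcal{G}(\lambda,f)$ is connected, $$\left|\{(f^{ -1}(a^2))^2:\ a\in\mathbb{F}_q\}\right|\neq \frac{q-1}{2}\quad\text{and}\quad \left|\{(f^{ -1}(\lambda a^2))^2:\ a\in\mathbb{F}_q\}\right|\neq \frac{q-1}{2}.$$ Then $\mathcal{G}(\lambda,f)$ has no Hamiltonian cycle of Type 1.
   Context: For a polynomial $f\in\mathbb{F}_q[X]$ and a non-square $\lambda\in\mathbb{F}_q$, $\mathcal{G}(\lambda,f)$ is the directed graph with vertex set $\mathbb{F}_q$ and an edge from $x$ to $y$ iff $(y^2-f(x))(\lambda y^2-f(x))=0$ (loops allowed). Here $f^{ -1}$ denotes the inverse of the bijection $x\mapsto f(x)$ of $\mathbb{F}_q$. Weights: an edge $(x,y)$ has weight $0$ if $y^2=f(x)$ and weight $1$ otherwise (i.e. if $\lambda y^2=f(x)$ but $y^2\ne f(x)$); in particular the edge into vertex $0$ has weight $0$. A trail is a directed path all of whose edges have the same weight; its length is its number of edges. A directed path is of Type $n$ if it contains a trail of length $n$ but no trail of length greater than $n$. A Hamiltonian cycle $H$ of a connected component is of Type $n$ if $H\setminus\{0\}$ (the cycle with vertex $0$ and its incident edges removed) is a path of Type $n$. -}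

module Defs where

open import Level using (Level; suc; _⊔_)
open import Data.Nat as ℕ using (ℕ)
open import Data.Nat.Primality using (Prime)
open import Data.Product using (Σ; ∃; ∃-syntax; _×_; _,_)
open import Data.List using (List; []; _∷_; _++_; length; map; deduplicate)
open import Data.List.Relation.Unary.All using (All)
open import Data.List.Relation.Unary.Unique.Propositional using (Unique)
open import Data.List.Membership.Propositional using (_∈_)
open import Relation.Binary.PropositionalEquality using (_≡_; _≢_)
open import Relation.Binary.Definitions using (DecidableEquality)
open import Data.Unit.Polymorphic using (⊤)
open import Data.Empty.Polymorphic using (⊥)
open import Data.Sum using (_⊎_)
open import Relation.Nullary using (¬_; yes; no)
open import Algebra.Structures using (IsCommutativeRing)
open import Algebra.Core using (Op₁; Op₂)

record FiniteField (c : Level) : Set (suc c) where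
  infixl 7 _*_
  infixl 6 _+_
  field
    Carrier : Set c
    _+_ _*_ : Op₂ Carrier
    -_      : Op₁ Carrier
    0# 1#   : Carrier
    isCommutativeRing : IsCommutativeRing _≡_ _+_ _*_ -_ 0# 1#
    _≟_     : DecidableEquality Carrier
    0≢1     : 0# ≢ 1#
    inverse : ∀ x → x ≢ 0# → ∃[ y ] (x * y ≡ 1#)
    elements : List Carrier
    elements-unique   : Unique elements
    elements-complete : ∀ x → x ∈ elements

  size : ℕ
  size = length elements

  sq : Carrier → Carrier
  sq x = x * x

  IsSquare : Carrier → Set c
  IsSquare x = ∃[ a ] (sq a ≡ x)

  -- polynomials as coefficient lists (constant term first), Horner evaluation
  Poly : Set c
  Poly = List Carrier

  eval : Poly → Carrier → Carrier
  eval []       x = 0#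
  eval (a ∷ as) x = a + x * eval as x

  imageSize : (Carrier → Carrier) → ℕ
  imageSize g = length (deduplicate _≟_ (map g elements))

module Graph {c : Level} (F : FiniteField c) (λ' : FiniteField.Carrier F)
             (f : FiniteField.Carrier F → FiniteField.Carrier F) where
  open FiniteField F

  Edge : Carrier → Carrier → Set c
  Edge x y = ((sq y + - f x) * (λ' * sq y + - f x)) ≡ 0#

  weight : Carrier → Carrier → ℕ
  weight x y with sq y ≟ f x
  ... | yes _ = 0
  ... | no  _ = 1

  Walk : List Carrier → Set c
  Walk []           = ⊤
  Walk (x ∷ [])     = ⊤
  Walk (x ∷ y ∷ vs) = Edge x y × Walk (y ∷ vs)

  weights : List Carrier → List ℕ
  weights []           = []
  weights (x ∷ [])     = []
  weights (x ∷ y ∷ vs) = weight x y ∷ weights (y ∷ vs)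

  HasTrail : ℕ → List Carrier → Set
  HasTrail n p = ∃[ as ] ∃[ ts ] ∃[ bs ] ∃[ w ]
    (weights p ≡ as ++ ts ++ bs × length ts ≡ n × All (_≡ w) ts)

  PathType : ℕ → List Carrier → Set
  PathType n p = HasTrail n p × (∀ m → n ℕ.< m → ¬ HasTrail m p)

  Reach : Carrier → Carrier → Set c
  Reach x y = x ≡ y ⊎ ∃[ vs ] (Walk (x ∷ vs ++ y ∷ []))

  Connected : Set c
  Connected = ∀ x y → Reach x y

  CyclicWalk : List Carrier → Set c
  CyclicWalk []       = ⊥
  CyclicWalk (v ∷ vs) = Walk (v ∷ vs ++ v ∷ [])

  HamiltonianCycle : List Carrier → Set c
  HamiltonianCycle cs = Unique cs × (∀ x → x ∈ cs) × CyclicWalk cs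

  -- H is of Type n if H with vertex 0 (and its incident edges) removed
  -- is a path of Type n: writing H = xs ++ 0 ∷ ys cyclically, that path is ys ++ xs
  CycleType : ℕ → List Carrier → Set c
  CycleType n cs = ∃[ xs ] ∃[ ys ] (cs ≡ xs ++ 0# ∷ ys × PathType n (ys ++ xs))

module Submission where

-- Rotate the cycle to 0, v₁, …, v_{q-1}, 0 and call the weight of the edge entering a vertex
-- its in-weight. As λ is a non-square, the characteristic is odd (in characteristic 2 every
-- element is a square), so y ≠ -y for y ≠ 0; since y and -y have the same square, edges of
-- equal weight into them would leave vertices with equal f-value, i.e. the same vertex.
-- So y ↦ -y swaps in-weights, and exactly (q-1)/2 vertices are entered by a weight-0 edge.
-- Type 1 means the weights along v₁ … v_{q-1} alternate; since 0s and 1s are equally frequent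
-- among the in-weights, the edge 0 → v₁ continues the alternation. Hence in- and out-weight
-- differ at every y with f(y) ≠ 0, and y, -y have different out-weights. If 0 → v₁ has weight 0,
-- every vertex x of out-weight 1 is f⁻¹(λa²) for its successor a, f⁻¹(λa²) is never 0, and the
-- squares of these values are exactly the squares of the vertices entered by weight 0: their
-- number is (q-1)/2. If 0 → v₁ has weight 1, the same holds for f⁻¹(a²).

open import Defs
open import Level using (Level)
open import Data.Nat using (ℕ; _∸_; _^_; _<_; _/_)
open import Data.Nat.Primality using (Prime)
open import Data.Product using (∃-syntax; _×_)
open import Data.List using (List)
open import Relation.Binary.PropositionalEquality using (_≡_; _≢_)
open import Relation.Nullary using (¬_)

open import Data.Nat as ℕ using (suc; _≤_; s≤s)
import Data.Nat.Properties as ℕ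
open import Data.Nat.DivMod using (m*n/n≡m)
open import Data.Product as Prod using (_,_)
open import Data.Sum as Sum using (_⊎_; inj₁; inj₂; [_,_])
open import Data.Empty using (⊥-elim)
open import Data.Unit.Polymorphic using (⊤; tt)
open import Data.Maybe using (fromMaybe)
open import Data.List using ([]; _∷_; _++_; length; map; filter; deduplicate; head)
open import Data.List.Properties
  using (length-removeAt′; length-map; filter-accept; filter-reject; map-cong-local; ++-assoc; ++-identityʳ)
open import Data.List.Relation.Unary.All as All using (All; []; _∷_)
import Data.List.Relation.Unary.All.Properties as AllP
open import Data.List.Relation.Unary.Any as Any using (here; there; index)
open import Data.List.Relation.Unary.AllPairs using ([]; _∷_)
open import Data.List.Relation.Unary.Unique.Propositional using (Unique)
import Data.List.Relation.Unary.Unique.Propositional.Properties as Unique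
open import Data.List.Relation.Unary.Unique.DecPropositional.Properties using (deduplicate-!)
open import Data.List.Membership.Propositional using (_∈_; _─_)
open import Data.List.Membership.Propositional.Properties
  using (∈-map⁺; ∈-map⁻; ∈-filter⁺; ∈-filter⁻; ∈-deduplicate⁺; ∈-deduplicate⁻)
open import Data.List.Relation.Binary.Subset.Propositional using (_⊆_)
open import Data.List.Relation.Binary.Permutation.Propositional using (_↭_; ↭⇒↭ₛ)
open import Data.List.Relation.Binary.Permutation.Propositional.Properties
  using (∈-resp-↭) renaming (++-comm to ↭-++-comm)
import Data.List.Relation.Binary.Permutation.Setoid.Properties as Permutation
open import Algebra.Bundles using (CommutativeRing)
open import Function using (_∘_)
open import Relation.Binary.Definitions using (DecidableEquality)
open import Relation.Binary.PropositionalEquality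
  using (refl; sym; trans; cong; cong₂; subst; setoid; module ≡-Reasoning)
open import Relation.Nullary using (yes; no)

module _ {a} {A : Set a} where

  ∈-─ : ∀ {x z : A} {ys} (x∈ys : x ∈ ys) → z ∈ ys → z ≢ x → z ∈ ys ─ x∈ys
  ∈-─ (here refl) (here refl)  z≢x = ⊥-elim (z≢x refl)
  ∈-─ (here refl) (there z∈ys) z≢x = z∈ys
  ∈-─ (there x∈ys) (here refl) z≢x = here refl
  ∈-─ (there x∈ys) (there z∈ys) z≢x = there (∈-─ x∈ys z∈ys z≢x)

  Unique⇒length≤ : ∀ {xs ys : List A} → Unique xs → xs ⊆ ys → length xs ≤ length ys
  Unique⇒length≤ {[]} _ _ = ℕ.z≤n
  Unique⇒length≤ {x ∷ xs} {ys} (x∉xs ∷ !xs) xs⊆ys = begin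
    suc (length xs)             ≤⟨ s≤s (Unique⇒length≤ !xs xs⊆ys─x) ⟩
    suc (length (ys ─ x∈ys))    ≡⟨ length-removeAt′ ys (index x∈ys) ⟨
    length ys                   ∎
    where
    open ℕ.≤-Reasoning
    x∈ys = xs⊆ys (here refl)
    xs⊆ys─x : xs ⊆ ys ─ x∈ys
    xs⊆ys─x z∈xs = ∈-─ x∈ys (xs⊆ys (there z∈xs)) λ { refl → All.lookup x∉xs z∈xs refl }

  Unique⇒length≡ : ∀ {xs ys : List A} → Unique xs → Unique ys → xs ⊆ ys → ys ⊆ xs → length xs ≡ length ys
  Unique⇒length≡ !xs !ys xs⊆ys ys⊆xs = ℕ.≤-antisym (Unique⇒length≤ !xs xs⊆ys) (Unique⇒length≤ !ys ys⊆xs)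

module _ {a b} {A : Set a} {B : Set b} where

  Unique-map⁺-on : ∀ (g : A → B) {xs} → (∀ {y z} → y ∈ xs → z ∈ xs → g y ≡ g z → y ≡ z) →
                   Unique xs → Unique (map g xs)
  Unique-map⁺-on g injective [] = []
  Unique-map⁺-on g injective (x∉xs ∷ !xs) =
    AllP.map⁺ (All.tabulate λ z∈xs → All.lookup x∉xs z∈xs ∘ injective (here refl) (there z∈xs))
    ∷ Unique-map⁺-on g (λ y∈xs z∈xs → injective (there y∈xs) (there z∈xs)) !xs

Bit : ℕ → Set
Bit n = n ≡ 0 ⊎ n ≡ 1

Bit-≢-other : ∀ {a b c} → Bit a → Bit b → Bit c → a ≢ b → c ≢ a → c ≡ b
Bit-≢-other (inj₁ refl) (inj₁ refl) _           a≢b _   = ⊥-elim (a≢b refl)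
Bit-≢-other (inj₂ refl) (inj₂ refl) _           a≢b _   = ⊥-elim (a≢b refl)
Bit-≢-other (inj₁ refl) (inj₂ refl) (inj₁ refl) _   c≢a = ⊥-elim (c≢a refl)
Bit-≢-other (inj₁ refl) (inj₂ refl) (inj₂ refl) _   _   = refl
Bit-≢-other (inj₂ refl) (inj₁ refl) (inj₁ refl) _   _   = refl
Bit-≢-other (inj₂ refl) (inj₁ refl) (inj₂ refl) _   c≢a = ⊥-elim (c≢a refl)

Bit-≢-cover : ∀ {a b k} → Bit a → Bit b → Bit k → a ≢ b → a ≡ k ⊎ b ≡ k
Bit-≢-cover {a} {b} {k} bit-a bit-b bit-k a≢b with a ℕ.≟ k
... | yes a≡k = inj₁ a≡k
... | no  a≢k = inj₂ (sym (Bit-≢-other bit-a bit-b bit-k a≢b (a≢k ∘ sym)))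

Alternating : List ℕ → Set
Alternating (a ∷ b ∷ ws) = a ≢ b × Alternating (b ∷ ws)
Alternating _            = ⊤

Alternating-tail : ∀ {a ws} → Alternating (a ∷ ws) → Alternating ws
Alternating-tail {ws = []}    _         = tt
Alternating-tail {ws = _ ∷ _} (_ , alt) = alt

count : ℕ → List ℕ → ℕ
count k []       = 0
count k (w ∷ ws) with w ℕ.≟ k
... | yes _ = suc (count k ws)
... | no  _ = count k ws

count-here : ∀ a ws → count a (a ∷ ws) ≡ suc (count a ws)
count-here a ws with a ℕ.≟ a
... | yes _   = refl
... | no  a≢a = ⊥-elim (a≢a refl)

count-there : ∀ {a b} ws → a ≢ b → count b (a ∷ ws) ≡ count b ws
count-there {a} {b} ws a≢b with a ℕ.≟ b
... | yes a≡b = ⊥-elim (a≢b a≡b)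
... | no  _   = refl

count-map : ∀ {a} {A : Set a} k (g : A → ℕ) xs → count k (map g xs) ≡ length (filter (λ x → g x ℕ.≟ k) xs)
count-map k g []       = refl
count-map k g (x ∷ xs) with g x ℕ.≟ k
... | yes gx≡k = trans (cong suc (count-map k g xs)) (cong length (sym (filter-accept (λ x → g x ℕ.≟ k) gx≡k)))
... | no  gx≢k = trans (count-map k g xs) (cong length (sym (filter-reject (λ x → g x ℕ.≟ k) gx≢k)))

count-0+count-1 : ∀ ws → All Bit ws → count 0 ws ℕ.+ count 1 ws ≡ length ws
count-0+count-1 []       []                = refl
count-0+count-1 (_ ∷ ws) (inj₁ refl ∷ bits) =
  cong suc (count-0+count-1 ws bits)
count-0+count-1 (_ ∷ ws) (inj₂ refl ∷ bits) =
  trans (ℕ.+-suc _ _) (cong suc (count-0+count-1 ws bits))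

Alternating-count : ∀ {a b} ws → Bit a → Bit b → a ≢ b → All Bit ws → Alternating (a ∷ ws) →
                    count a (a ∷ ws) ≡ count b (a ∷ ws) ⊎ count a (a ∷ ws) ≡ suc (count b (a ∷ ws))
Alternating-count {a} {b} [] _ _ a≢b _ _ =
  inj₂ (trans (count-here a []) (cong suc (sym (count-there [] a≢b))))
Alternating-count {a} {b} (d ∷ r) bit-a bit-b a≢b (bit-d ∷ bits) (a≢d , alt)
  with refl ← Bit-≢-other bit-a bit-b bit-d a≢b (a≢d ∘ sym)
  with Alternating-count r bit-b bit-a (a≢b ∘ sym) bits alt
... | inj₁ cb≡ca = inj₂ (begin
  count a (a ∷ b ∷ r)      ≡⟨ count-here a (b ∷ r) ⟩
  suc (count a (b ∷ r))    ≡⟨ cong suc cb≡ca ⟨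
  suc (count b (b ∷ r))    ≡⟨ cong suc (count-there (b ∷ r) a≢b) ⟨
  suc (count b (a ∷ b ∷ r)) ∎)
  where open ≡-Reasoning
... | inj₂ cb≡1+ca = inj₁ (begin
  count a (a ∷ b ∷ r)      ≡⟨ count-here a (b ∷ r) ⟩
  suc (count a (b ∷ r))    ≡⟨ cb≡1+ca ⟨
  count b (b ∷ r)          ≡⟨ count-there (b ∷ r) a≢b ⟨
  count b (a ∷ b ∷ r)      ∎)
  where open ≡-Reasoning

repeat⇒count≢ : ∀ {a b} ws → Bit a → Bit b → a ≢ b → All Bit ws → Alternating (a ∷ ws) →
                    count a (a ∷ a ∷ ws) ≢ count b (a ∷ a ∷ ws)
repeat⇒count≢ {a} {b} ws bit-a bit-b a≢b bits alt balanced =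
  [ (λ ca≡cb   → ℕ.1+n≢n (trans balanced′ (sym ca≡cb)))
  , (λ ca≡1+cb → ℕ.<⇒≢ (ℕ.m<n⇒m<1+n (ℕ.n<1+n _)) (sym (trans (cong suc (sym ca≡1+cb)) balanced′)))
  ] (Alternating-count ws bit-a bit-b a≢b bits alt)
  where
  balanced′ : suc (count a (a ∷ ws)) ≡ count b (a ∷ ws)
  balanced′ = trans (sym (count-here a (a ∷ ws))) (trans balanced (count-there (a ∷ ws) a≢b))

Balanced : List ℕ → Set
Balanced ws = count 0 ws ≡ count 1 ws

Balanced⇒Alternating : ∀ w ws → All Bit (w ∷ ws) → Alternating ws → Balanced (w ∷ ws) → Alternating (w ∷ ws)
Balanced⇒Alternating w []       _                  _   _        = tt
Balanced⇒Alternating w (v ∷ ws) (bit-w ∷ _ ∷ bits) alt balanced = w≢v bit-w , alt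
  where
  w≢v : Bit w → w ≢ v
  w≢v (inj₁ refl) refl = repeat⇒count≢ ws (inj₁ refl) (inj₂ refl) (λ ()) bits alt balanced
  w≢v (inj₂ refl) refl = repeat⇒count≢ ws (inj₂ refl) (inj₁ refl) (λ ()) bits alt (sym balanced)

no-repeat⇒Alternating : ∀ ws → (∀ as w bs → ws ≢ as ++ w ∷ w ∷ bs) → Alternating ws
no-repeat⇒Alternating []           _         = tt
no-repeat⇒Alternating (_ ∷ [])     _         = tt
no-repeat⇒Alternating (a ∷ b ∷ ws) no-repeat =
  (λ { refl → no-repeat [] a ws refl }) ,
  no-repeat⇒Alternating (b ∷ ws) (λ as w bs eq → no-repeat (a ∷ as) w bs (cong (a ∷_) eq))

module _ {a} {A : Set a} (_≟_ : DecidableEquality A) where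

  before : A → List A → A → A
  before p []       y = p
  before p (x ∷ xs) y with x ≟ y
  ... | yes _ = p
  ... | no  _ = before x xs y

  after : A → List A → A → A
  after d []       y = d
  after d (x ∷ xs) y with x ≟ y
  ... | yes _ = fromMaybe d (head xs)
  ... | no  _ = after d xs y

  before-here : ∀ p x xs → before p (x ∷ xs) x ≡ p
  before-here p x xs with x ≟ x
  ... | yes _   = refl
  ... | no  x≢x = ⊥-elim (x≢x refl)

  before-there : ∀ p {x} xs {y} → x ≢ y → before p (x ∷ xs) y ≡ before x xs y
  before-there p {x} xs {y} x≢y with x ≟ y
  ... | yes x≡y = ⊥-elim (x≢y x≡y)
  ... | no  _   = refl

  before∈ : ∀ p xs y → before p xs y ∈ p ∷ xs
  before∈ p []       y = here refl
  before∈ p (x ∷ xs) y with x ≟ y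
  ... | yes _ = here refl
  ... | no  _ = there (before∈ x xs y)

  before-injective : ∀ p xs {y z} → Unique (p ∷ xs) → y ∈ xs → z ∈ xs → before p xs y ≡ before p xs z → y ≡ z
  before-injective p (x ∷ xs) {y} {z} (p∉ ∷ !xs) y∈ z∈ eq with x ≟ y | x ≟ z
  ... | yes x≡y | yes x≡z = trans (sym x≡y) x≡z
  ... | yes _   | no  _   = ⊥-elim (All.lookup p∉ (subst (_∈ x ∷ xs) (sym eq) (before∈ x xs z)) refl)
  ... | no  _   | yes _   = ⊥-elim (All.lookup p∉ (subst (_∈ x ∷ xs) eq (before∈ x xs y)) refl)
  ... | no  x≢y | no  x≢z = before-injective x xs !xs (Any.tail (x≢y ∘ sym) y∈) (Any.tail (x≢z ∘ sym) z∈) eq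

module FiniteFieldProperties {c} (F : FiniteField c) where
  open FiniteField F

  commutativeRing : CommutativeRing c c
  commutativeRing = record { isCommutativeRing = isCommutativeRing }

  open CommutativeRing commutativeRing
    using (+-comm; +-assoc; +-identityˡ; -‿inverseʳ; *-comm; *-assoc; *-identityˡ; *-identityʳ;
           zeroˡ; zeroʳ; distribˡ; distribʳ; ring; +-group) public
  open import Algebra.Properties.Ring ring using (-‿distribˡ-*; -‿distribʳ-*; [y-z]x≈yx-zx)
  open import Algebra.Properties.Group +-group
    using (inverseʳ-unique; x∙y⁻¹≈ε⇒x≈y; ⁻¹-involutive; ⁻¹-injective; ε⁻¹≈ε; ⁻¹-anti-homo-∙) public
  open import Algebra.Properties.CommutativeSemigroup (CommutativeRing.*-commutativeSemigroup commutativeRing)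
    using (interchange)
  open import Data.List.Membership.DecPropositional _≟_ using (_∈?_)
  open ≡-Reasoning

  zero-product : ∀ a b → a * b ≡ 0# → a ≡ 0# ⊎ b ≡ 0#
  zero-product a b ab≡0 with a ≟ 0#
  ... | yes a≡0 = inj₁ a≡0
  ... | no  a≢0 with a⁻¹ , aa⁻¹≡1 ← inverse a a≢0 = inj₂ (begin
    b                ≡⟨ *-identityˡ b ⟨
    1# * b           ≡⟨ cong (_* b) (trans (sym aa⁻¹≡1) (*-comm a a⁻¹)) ⟩
    (a⁻¹ * a) * b    ≡⟨ *-assoc a⁻¹ a b ⟩
    a⁻¹ * (a * b)    ≡⟨ cong (a⁻¹ *_) ab≡0 ⟩
    a⁻¹ * 0#         ≡⟨ zeroʳ a⁻¹ ⟩
    0#               ∎)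

  sq≡0⇒≡0 : ∀ y → sq y ≡ 0# → y ≡ 0#
  sq≡0⇒≡0 y yy≡0 = Sum.reduce (zero-product y y yy≡0)

  -‿≢0 : ∀ {y} → y ≢ 0# → - y ≢ 0#
  -‿≢0 y≢0 -y≡0 = y≢0 (⁻¹-injective (trans -y≡0 (sym ε⁻¹≈ε)))

  sq-neg : ∀ y → sq (- y) ≡ sq y
  sq-neg y = begin
    - y * - y        ≡⟨ -‿distribˡ-* y (- y) ⟨
    - (y * - y)      ≡⟨ cong -_ (-‿distribʳ-* y y) ⟨
    - (- (y * y))    ≡⟨ ⁻¹-involutive (y * y) ⟩
    y * y            ∎

  difference-of-squares : ∀ y z → (y + - z) * (y + z) ≡ sq y + - sq z
  difference-of-squares y z = begin
    (y + - z) * (y + z)                   ≡⟨ [y-z]x≈yx-zx (y + z) y z ⟩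
    y * (y + z) + - (z * (y + z))         ≡⟨ cong₂ (λ s t → s + - t) (distribˡ y y z) (distribˡ z y z) ⟩
    (y * y + y * z) + - (z * y + z * z)   ≡⟨ cong (λ t → (y * y + y * z) + - (t + z * z)) (*-comm z y) ⟩
    (y * y + y * z) + - (y * z + z * z)   ≡⟨ cong ((y * y + y * z) +_) (⁻¹-anti-homo-∙ (y * z) (z * z)) ⟩
    (y * y + y * z) + (- (z * z) + - (y * z))  ≡⟨ cong ((y * y + y * z) +_) (+-comm (- (z * z)) _) ⟩
    (y * y + y * z) + (- (y * z) + - (z * z))  ≡⟨ +-assoc (y * y) (y * z) _ ⟩
    y * y + (y * z + (- (y * z) + - (z * z)))  ≡⟨ cong (y * y +_) (+-assoc (y * z) _ _) ⟨
    y * y + ((y * z + - (y * z)) + - (z * z))  ≡⟨ cong (λ t → y * y + (t + - (z * z))) (-‿inverseʳ (y * z)) ⟩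
    y * y + (0# + - (z * z))              ≡⟨ cong (y * y +_) (+-identityˡ _) ⟩
    y * y + - (z * z)                     ∎

  sq-injective-up-to-sign : ∀ y z → sq y ≡ sq z → z ≡ y ⊎ z ≡ - y
  sq-injective-up-to-sign y z yy≡zz =
    [ (λ y-z≡0 → inj₁ (sym (x∙y⁻¹≈ε⇒x≈y y z y-z≡0)))
    , (λ y+z≡0 → inj₂ (inverseʳ-unique y z y+z≡0))
    ] (zero-product (y + - z) (y + z) (begin
        (y + - z) * (y + z)   ≡⟨ difference-of-squares y z ⟩
        sq y + - sq z         ≡⟨ cong (_+ - sq z) yy≡zz ⟩
        sq z + - sq z         ≡⟨ -‿inverseʳ (sq z) ⟩
        0#                    ∎))

  y+y≡2y : ∀ y → y + y ≡ (1# + 1#) * y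
  y+y≡2y y = begin
    y + y              ≡⟨ cong₂ _+_ (*-identityˡ y) (*-identityˡ y) ⟨
    1# * y + 1# * y    ≡⟨ distribʳ y 1# 1# ⟨
    (1# + 1#) * y      ∎

  y≢-y : 1# + 1# ≢ 0# → ∀ {y} → y ≢ 0# → y ≢ - y
  y≢-y 2≢0 {y} y≢0 y≡-y =
    [ 2≢0 , y≢0 ] (zero-product (1# + 1#) y (begin
      (1# + 1#) * y   ≡⟨ y+y≡2y y ⟨
      y + y           ≡⟨ cong (y +_) y≡-y ⟩
      y + - y         ≡⟨ -‿inverseʳ y ⟩
      0#              ∎))

  char-2⇒IsSquare : 1# + 1# ≡ 0# → ∀ x → IsSquare x
  char-2⇒IsSquare 2≡0 x with x ∈? map sq elements
  ... | yes x∈squares with a , _ , x≡aa ← ∈-map⁻ sq x∈squares = a , sym x≡aa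
  ... | no  x∉squares = ⊥-elim (ℕ.1+n≰n (subst (λ n → suc n ≤ length elements) (length-map sq elements)
                          (Unique⇒length≤ (x∉squares′ ∷ squares-unique) (λ {z} _ → elements-complete z))))
    where
    x∉squares′ : All (x ≢_) (map sq elements)
    x∉squares′ = All.tabulate λ z∈squares x≡z → x∉squares (subst (_∈ map sq elements) (sym x≡z) z∈squares)
    -y≡y : ∀ y → - y ≡ y
    -y≡y y = sym (inverseʳ-unique y y (trans (y+y≡2y y) (trans (cong (_* y) 2≡0) (zeroˡ y))))
    squares-unique : Unique (map sq elements)
    squares-unique = Unique.map⁺ (λ {y} {z} yy≡zz →
      sym ([ (λ z≡y → z≡y) , (λ z≡-y → trans z≡-y (-y≡y y)) ] (sq-injective-up-to-sign y z yy≡zz)))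
      elements-unique

  nonsquare⇒2≢0 : ∀ {λ'} → ¬ IsSquare λ' → 1# + 1# ≢ 0#
  nonsquare⇒2≢0 {λ'} λ'-nonsquare 2≡0 = λ'-nonsquare (char-2⇒IsSquare 2≡0 λ')

  nonsquare*sq≢sq : ∀ {λ' a b} → ¬ IsSquare λ' → a ≢ 0# → λ' * sq a ≢ sq b
  nonsquare*sq≢sq {λ'} {a} {b} λ'-nonsquare a≢0 λ'aa≡bb with a⁻¹ , aa⁻¹≡1 ← inverse a a≢0 =
    λ'-nonsquare (b * a⁻¹ , (begin
      (b * a⁻¹) * (b * a⁻¹)       ≡⟨ interchange b a⁻¹ b a⁻¹ ⟩
      (b * b) * (a⁻¹ * a⁻¹)       ≡⟨ cong (_* (a⁻¹ * a⁻¹)) λ'aa≡bb ⟨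
      (λ' * (a * a)) * (a⁻¹ * a⁻¹) ≡⟨ *-assoc λ' _ _ ⟩
      λ' * ((a * a) * (a⁻¹ * a⁻¹)) ≡⟨ cong (λ' *_) (interchange a a a⁻¹ a⁻¹) ⟩
      λ' * ((a * a⁻¹) * (a * a⁻¹)) ≡⟨ cong (λ t → λ' * (t * t)) aa⁻¹≡1 ⟩
      λ' * (1# * 1#)              ≡⟨ cong (λ' *_) (*-identityˡ 1#) ⟩
      λ' * 1#                     ≡⟨ *-identityʳ λ' ⟩
      λ'                          ∎))

  imageSize≡length : ∀ (g : Carrier → Carrier) {R} → Unique R → (∀ a → g a ∈ R) → (∀ {z} → z ∈ R → ∃[ a ] g a ≡ z) →
                     imageSize g ≡ length R
  imageSize≡length g {R} R-unique g∈R onto =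
    Unique⇒length≡ (deduplicate-! _≟_ (map g elements)) R-unique image⊆R R⊆image
    where
    image⊆R : deduplicate _≟_ (map g elements) ⊆ R
    image⊆R z∈image with a , _ , refl ← ∈-map⁻ g (∈-deduplicate⁻ _≟_ (map g elements) z∈image) = g∈R a
    R⊆image : R ⊆ deduplicate _≟_ (map g elements)
    R⊆image z∈R with a , refl ← onto z∈R = ∈-deduplicate⁺ _≟_ (∈-map⁺ g (elements-complete a))

  size≡length : ∀ {xs} → Unique xs → (∀ z → z ∈ xs) → size ≡ length xs
  size≡length xs-unique xs-complete =
    Unique⇒length≡ elements-unique xs-unique (λ {z} _ → xs-complete z) (λ {z} _ → elements-complete z)

module GraphProperties {c} (F : FiniteField c) (λ' : FiniteField.Carrier F) (φ : FiniteField.Carrier F → FiniteField.Carrier F) where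
  open FiniteField F
  open FiniteFieldProperties F
  open Graph F λ' φ

  weight-Bit : ∀ x y → Bit (weight x y)
  weight-Bit x y with sq y ≟ φ x
  ... | yes _ = inj₁ refl
  ... | no  _ = inj₂ refl

  weights-Bit : ∀ vs → All Bit (weights vs)
  weights-Bit []           = []
  weights-Bit (_ ∷ [])     = []
  weights-Bit (x ∷ y ∷ vs) = weight-Bit x y ∷ weights-Bit (y ∷ vs)

  weight≡0⇒ : ∀ {x y} → weight x y ≡ 0 → sq y ≡ φ x
  weight≡0⇒ {x} {y} w≡0 with sq y ≟ φ x
  ... | yes yy≡φx = yy≡φx
  ... | no  _     with () ← w≡0

  Edge⇒ : ∀ {x y} → Edge x y → sq y ≡ φ x ⊎ λ' * sq y ≡ φ x
  Edge⇒ {x} {y} edge with zero-product _ _ edge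
  ... | inj₁ yy-φx≡0  = inj₁ (x∙y⁻¹≈ε⇒x≈y _ _ yy-φx≡0)
  ... | inj₂ λyy-φx≡0 = inj₂ (x∙y⁻¹≈ε⇒x≈y _ _ λyy-φx≡0)

  Edge-weight≡1⇒ : ∀ {x y} → Edge x y → weight x y ≡ 1 → λ' * sq y ≡ φ x
  Edge-weight≡1⇒ {x} {y} edge w≡1 with sq y ≟ φ x | Edge⇒ edge
  ... | yes _     | _            with () ← w≡1
  ... | no  yy≢φx | inj₁ yy≡φx  = ⊥-elim (yy≢φx yy≡φx)
  ... | no  _     | inj₂ λyy≡φx = λyy≡φx

  Edge-into-0 : ∀ {x} → Edge x 0# → φ x ≡ 0#
  Edge-into-0 edge with Edge⇒ edge
  ... | inj₁ 00≡φx  = trans (sym 00≡φx) (zeroˡ 0#)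
  ... | inj₂ λ00≡φx = trans (sym λ00≡φx) (trans (cong (λ' *_) (zeroˡ 0#)) (zeroʳ λ'))

  Walk-++⁻ : ∀ as b bs → Walk (as ++ b ∷ bs) → Walk (as ++ b ∷ []) × Walk (b ∷ bs)
  Walk-++⁻ []            b bs walk          = tt , walk
  Walk-++⁻ (a ∷ [])      b bs (edge , walk) = (edge , tt) , walk
  Walk-++⁻ (a ∷ a′ ∷ as) b bs (edge , walk) with Walk-++⁻ (a′ ∷ as) b bs walk
  ... | walk₁ , walk₂ = (edge , walk₁) , walk₂

  Walk-++⁺ : ∀ as b bs → Walk (as ++ b ∷ []) → Walk (b ∷ bs) → Walk (as ++ b ∷ bs)
  Walk-++⁺ []            b bs _              walk₂ = walk₂
  Walk-++⁺ (a ∷ [])      b bs (edge , _)     walk₂ = edge , walk₂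
  Walk-++⁺ (a ∷ a′ ∷ as) b bs (edge , walk₁) walk₂ = edge , Walk-++⁺ (a′ ∷ as) b bs walk₁ walk₂

  CyclicWalk-rotate : ∀ xs v ys → CyclicWalk (xs ++ v ∷ ys) → CyclicWalk (v ∷ ys ++ xs)
  CyclicWalk-rotate []       v ys cycle = subst (λ zs → Walk (v ∷ zs ++ v ∷ [])) (sym (++-identityʳ ys)) cycle
  CyclicWalk-rotate (x ∷ xs) v ys cycle
    with walk₁ , walk₂ ← Walk-++⁻ (x ∷ xs) v (ys ++ x ∷ [])
                           (subst (λ zs → Walk (x ∷ zs)) (++-assoc xs (v ∷ ys) (x ∷ [])) cycle)
    = subst (λ zs → Walk (v ∷ zs)) (sym (++-assoc ys (x ∷ xs) (v ∷ [])))
        (Walk-++⁺ (v ∷ ys) x (xs ++ v ∷ []) walk₂ walk₁)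

  ¬HasTrail2⇒Alternating : ∀ vs → ¬ HasTrail 2 vs → Alternating (weights vs)
  ¬HasTrail2⇒Alternating vs no-trail = no-repeat⇒Alternating (weights vs)
    λ as w bs weights≡ → no-trail (as , w ∷ w ∷ [] , bs , w , weights≡ , refl , refl ∷ refl ∷ [])

  Edge-before : ∀ p xs ys {y} → Walk (p ∷ xs ++ ys) → y ∈ xs → Edge (before _≟_ p xs y) y
  Edge-before p (x ∷ xs) ys {y} (edge , walk) y∈ with x ≟ y
  ... | yes refl = edge
  ... | no  x≢y  = Edge-before x xs ys walk (Any.tail (x≢y ∘ sym) y∈)

  Edge-after : ∀ d xs {y} → Walk (xs ++ d ∷ []) → y ∈ xs → Edge y (after _≟_ d xs y)
  Edge-after d (x ∷ xs) {y} walk y∈ with x ≟ y | xs | walk | y∈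
  ... | yes refl | []     | edge , _  | _        = edge
  ... | yes refl | _ ∷ _  | edge , _  | _        = edge
  ... | no  x≢y  | []     | _         | here y≡x = ⊥-elim (x≢y (sym y≡x))
  ... | no  x≢y  | z ∷ zs | _ , walk′ | y∈z∷zs   = Edge-after d (z ∷ zs) walk′ (Any.tail (x≢y ∘ sym) y∈z∷zs)

  weights-before : ∀ p xs → Unique (p ∷ xs) → map (λ y → weight (before _≟_ p xs y) y) xs ≡ weights (p ∷ xs)
  weights-before p []       _                  = refl
  weights-before p (x ∷ xs) (_ ∷ !x∷xs@(x∉ ∷ _)) =
    cong₂ _∷_ (cong (λ t → weight t x) (before-here _≟_ p x xs))
      (trans (map-cong-local (All.map (λ x≢y → cong (λ t → weight t _) (before-there _≟_ p xs x≢y)) x∉))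
             (weights-before x xs !x∷xs))

  Alternating-before-after : ∀ p d xs {y} → Alternating (weights (p ∷ xs)) → after _≟_ d xs y ≢ d →
                             weight (before _≟_ p xs y) y ≢ weight y (after _≟_ d xs y)
  Alternating-before-after p d []       alt not-last = ⊥-elim (not-last refl)
  Alternating-before-after p d (x ∷ xs) {y} alt not-last with x ≟ y | xs | alt
  ... | yes refl | []    | _        = ⊥-elim (not-last refl)
  ... | yes refl | _ ∷ _ | w≢w′ , _ = w≢w′
  ... | no  _    | xs′   | alt′     = Alternating-before-after x d xs′ (Alternating-tail alt′) not-last

  length-weights : ∀ x vs → length (weights (x ∷ vs)) ≡ length vs
  length-weights x []       = refl
  length-weights x (v ∷ vs) = cong suc (length-weights v vs)

  Balanced⇒Alternating-weights : ∀ x vs → Alternating (weights vs) → Balanced (weights (x ∷ vs)) →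
                                 Alternating (weights (x ∷ vs))
  Balanced⇒Alternating-weights x []       _   _        = tt
  Balanced⇒Alternating-weights x (v ∷ vs) alt balanced =
    Balanced⇒Alternating (weight x v) (weights (v ∷ vs)) (weights-Bit (x ∷ v ∷ vs)) alt balanced

module HamiltonianCycleOfType1 {c} (F : FiniteField c) where
  open FiniteField F
  open FiniteFieldProperties F

  module _
    (λ' : Carrier) (λ'-nonsquare : ¬ IsSquare λ')
    (φ φ⁻¹ : Carrier → Carrier) (φ⁻¹∘φ : ∀ x → φ⁻¹ (φ x) ≡ x) (φ∘φ⁻¹ : ∀ y → φ (φ⁻¹ y) ≡ y)
    (P : List Carrier) (0∷P-unique : Unique (0# ∷ P)) (0∷P-complete : ∀ z → z ∈ 0# ∷ P)
    (cycle : Graph.CyclicWalk F λ' φ (0# ∷ P))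
    (P-alternating : Alternating (Graph.weights F λ' φ P))
    where
    open Graph F λ' φ
    open GraphProperties F λ' φ
    open ≡-Reasoning

    P-unique : Unique P
    P-unique = Unique.drop⁺ 1 0∷P-unique

    ∈P⇒≢0 : ∀ {y} → y ∈ P → y ≢ 0#
    ∈P⇒≢0 y∈P refl = Unique.Unique[x∷xs]⇒x∉xs 0∷P-unique y∈P

    ≢0⇒∈P : ∀ {y} → y ≢ 0# → y ∈ P
    ≢0⇒∈P {y} y≢0 = Any.tail y≢0 (0∷P-complete y)

    φ-injective : ∀ {x y} → φ x ≡ φ y → x ≡ y
    φ-injective {x} {y} φx≡φy = trans (sym (φ⁻¹∘φ x)) (trans (cong φ⁻¹ φx≡φy) (φ⁻¹∘φ y))

    pred : Carrier → Carrier
    pred = before _≟_ 0# P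

    -- The default 0# returned after the last vertex of P is its successor on the cycle.
    next : Carrier → Carrier
    next = after _≟_ 0# (0# ∷ P)

    in-weight out-weight : Carrier → ℕ
    in-weight  y = weight (pred y) y
    out-weight x = weight x (next x)

    Edge-pred : ∀ {y} → y ∈ P → Edge (pred y) y
    Edge-pred = Edge-before 0# P (0# ∷ []) cycle

    Edge-next : ∀ x → Edge x (next x)
    Edge-next x = Edge-after 0# (0# ∷ P) cycle (0∷P-complete x)

    next-0∈P : next 0# ∈ P
    next-0∈P with 0# ≟ 0#
    ... | yes _   = head∈ P (≢0⇒∈P (0≢1 ∘ sym))
      where
      head∈ : ∀ {z} xs → z ∈ xs → fromMaybe 0# (head xs) ∈ xs
      head∈ (_ ∷ _) _ = here refl
    ... | no  0≢0 = ⊥-elim (0≢0 refl)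

    v₁ : Carrier
    v₁ = next 0#

    v₁≢0 : v₁ ≢ 0#
    v₁≢0 = ∈P⇒≢0 next-0∈P

    next-≢0 : ∀ {y} → y ≢ 0# → next y ≡ after _≟_ 0# P y
    next-≢0 {y} y≢0 with 0# ≟ y
    ... | yes 0≡y = ⊥-elim (y≢0 (sym 0≡y))
    ... | no  _   = refl

    in-weight-Bit : ∀ y → Bit (in-weight y)
    in-weight-Bit y = weight-Bit (pred y) y

    out-weight-Bit : ∀ x → Bit (out-weight x)
    out-weight-Bit x = weight-Bit x (next x)

    in-weight-neg : ∀ {y} → y ≢ 0# → in-weight y ≢ in-weight (- y)
    in-weight-neg {y} y≢0 same-weight =
      y≢-y (nonsquare⇒2≢0 λ'-nonsquare) y≢0
        (before-injective _≟_ 0# P 0∷P-unique (≢0⇒∈P y≢0) (≢0⇒∈P (-‿≢0 y≢0)) (φ-injective same-φ))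
      where
      same-φ : φ (pred y) ≡ φ (pred (- y))
      same-φ with in-weight-Bit y
      ... | inj₁ w≡0 = trans (sym (weight≡0⇒ w≡0)) (trans (sym (sq-neg y)) (weight≡0⇒ (trans (sym same-weight) w≡0)))
      ... | inj₂ w≡1 =
        trans (sym (Edge-weight≡1⇒ (Edge-pred (≢0⇒∈P y≢0)) w≡1))
          (trans (cong (λ' *_) (sym (sq-neg y)))
            (Edge-weight≡1⇒ (Edge-pred (≢0⇒∈P (-‿≢0 y≢0))) (trans (sym same-weight) w≡1)))

    entered-by : ℕ → List Carrier
    entered-by k = filter (λ y → in-weight y ℕ.≟ k) P

    ∈-entered-by⁺ : ∀ {y k} → y ≢ 0# → in-weight y ≡ k → y ∈ entered-by k
    ∈-entered-by⁺ {k = k} y≢0 w≡k = ∈-filter⁺ (λ y → in-weight y ℕ.≟ k) (≢0⇒∈P y≢0) w≡k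

    ∈-entered-by⁻ : ∀ {y k} → y ∈ entered-by k → y ≢ 0# × in-weight y ≡ k
    ∈-entered-by⁻ {k = k} y∈ with y∈P , w≡k ← ∈-filter⁻ (λ y → in-weight y ℕ.≟ k) y∈ = ∈P⇒≢0 y∈P , w≡k

    entered-by-unique : ∀ k → Unique (entered-by k)
    entered-by-unique k = Unique.filter⁺ (λ y → in-weight y ℕ.≟ k) P-unique

    in-weight-neg-0 : ∀ {y} → y ≢ 0# → in-weight y ≡ 1 → in-weight (- y) ≡ 0
    in-weight-neg-0 {y} y≢0 w≡1 =
      Bit-≢-other (in-weight-Bit y) (inj₁ refl) (in-weight-Bit (- y)) (λ w≡0 → ℕ.1+n≢0 (trans (sym w≡1) w≡0))
        (in-weight-neg y≢0 ∘ sym)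

    in-weight-neg-1 : ∀ {y} → y ≢ 0# → in-weight y ≡ 0 → in-weight (- y) ≡ 1
    in-weight-neg-1 {y} y≢0 w≡0 =
      Bit-≢-other (in-weight-Bit y) (inj₂ refl) (in-weight-Bit (- y)) (λ w≡1 → ℕ.0≢1+n (trans (sym w≡0) w≡1))
        (in-weight-neg y≢0 ∘ sym)

    entered-by-0-≡-entered-by-1 : length (entered-by 0) ≡ length (entered-by 1)
    entered-by-0-≡-entered-by-1 =
      trans (sym (length-map -_ (entered-by 0)))
        (Unique⇒length≡ (Unique.map⁺ ⁻¹-injective (entered-by-unique 0)) (entered-by-unique 1) negated⊆ ⊆negated)
      where
      negated⊆ : map -_ (entered-by 0) ⊆ entered-by 1
      negated⊆ z∈ with y , y∈ , refl ← ∈-map⁻ -_ z∈ with y≢0 , w≡0 ← ∈-entered-by⁻ y∈ =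
        ∈-entered-by⁺ (-‿≢0 y≢0) (in-weight-neg-1 y≢0 w≡0)
      ⊆negated : entered-by 1 ⊆ map -_ (entered-by 0)
      ⊆negated {z} z∈ with z≢0 , w≡1 ← ∈-entered-by⁻ z∈ =
        subst (_∈ map -_ (entered-by 0)) (⁻¹-involutive z)
          (∈-map⁺ -_ (∈-entered-by⁺ (-‿≢0 z≢0) (in-weight-neg-0 z≢0 w≡1)))

    count-in-weights : ∀ k → count k (weights (0# ∷ P)) ≡ length (entered-by k)
    count-in-weights k = trans (cong (count k) (sym (weights-before 0# P 0∷P-unique))) (count-map k in-weight P)

    cycle-balanced : Balanced (weights (0# ∷ P))
    cycle-balanced = trans (count-in-weights 0) (trans entered-by-0-≡-entered-by-1 (sym (count-in-weights 1)))

    cycle-alternating : Alternating (weights (0# ∷ P))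
    cycle-alternating = Balanced⇒Alternating-weights 0# P P-alternating cycle-balanced

    length-entered-by-0 : length (entered-by 0) ≡ (size ∸ 1) / 2
    length-entered-by-0 = sym (begin
      (size ∸ 1) / 2                                        ≡⟨ cong (λ m → (m ∸ 1) / 2) (size≡length 0∷P-unique 0∷P-complete) ⟩
      length P / 2                                          ≡⟨ cong (_/ 2) (length-weights 0# P) ⟨
      length ws / 2                                         ≡⟨ cong (_/ 2) (count-0+count-1 ws (weights-Bit (0# ∷ P))) ⟨
      (count 0 ws ℕ.+ count 1 ws) / 2                       ≡⟨ cong (λ m → (count 0 ws ℕ.+ m) / 2) cycle-balanced ⟨
      (count 0 ws ℕ.+ count 0 ws) / 2                       ≡⟨ cong (_/ 2) (cong (count 0 ws ℕ.+_) (ℕ.+-identityʳ _)) ⟨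
      2 ℕ.* count 0 ws / 2                                  ≡⟨ cong (_/ 2) (ℕ.*-comm 2 (count 0 ws)) ⟩
      count 0 ws ℕ.* 2 / 2                                  ≡⟨ m*n/n≡m (count 0 ws) 2 ⟩
      count 0 ws                                            ≡⟨ count-in-weights 0 ⟩
      length (entered-by 0)                                 ∎)
      where
      ws = weights (0# ∷ P)

    in-weight≢out-weight : ∀ {y} → y ≢ 0# → φ y ≢ 0# → in-weight y ≢ out-weight y
    in-weight≢out-weight {y} y≢0 φy≢0 =
      subst (λ z → in-weight y ≢ weight y z) (sym (next-≢0 y≢0))
        (Alternating-before-after 0# 0# P cycle-alternating not-last)
      where
      not-last : after _≟_ 0# P y ≢ 0#
      not-last after≡0 = φy≢0 (Edge-into-0 (subst (Edge y) (trans (next-≢0 y≢0) after≡0) (Edge-next y)))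

    out-weight-neg : ∀ {y} → y ≢ 0# → φ y ≢ 0# → φ (- y) ≢ 0# → out-weight y ≢ out-weight (- y)
    out-weight-neg {y} y≢0 φy≢0 φ-y≢0 same-weight = in-weight-neg y≢0 (begin
      in-weight y         ≡⟨ out-weight≡in-weight (- y) (-‿≢0 y≢0) φ-y≢0 (in-weight-neg y≢0 ∘ sym) ⟨
      out-weight (- y)    ≡⟨ same-weight ⟨
      out-weight y        ≡⟨ out-weight≡in-weight y y≢0 φy≢0 (in-weight-neg y≢0) ⟩
      in-weight (- y)     ∎)
      where
      out-weight≡in-weight : ∀ x {x′} → x ≢ 0# → φ x ≢ 0# → in-weight x ≢ in-weight x′ → out-weight x ≡ in-weight x′
      out-weight≡in-weight x {x′} x≢0 φx≢0 in≢in′ =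
        Bit-≢-other (in-weight-Bit x) (in-weight-Bit x′) (out-weight-Bit x) in≢in′ (in-weight≢out-weight x≢0 φx≢0 ∘ sym)

    squares : List Carrier
    squares = map sq (entered-by 0)

    squares-unique : Unique squares
    squares-unique = Unique-map⁺-on sq sq-injective (entered-by-unique 0)
      where
      sq-injective : ∀ {y z} → y ∈ entered-by 0 → z ∈ entered-by 0 → sq y ≡ sq z → y ≡ z
      sq-injective {y} {z} y∈ z∈ yy≡zz with sq-injective-up-to-sign y z yy≡zz
      ... | inj₁ z≡y  = sym z≡y
      ... | inj₂ refl with y≢0 , w≡0 ← ∈-entered-by⁻ y∈ | _ , w′≡0 ← ∈-entered-by⁻ z∈ =
        ⊥-elim (in-weight-neg y≢0 (trans w≡0 (sym w′≡0)))

    sq∈squares : ∀ {x} → x ≢ 0# → sq x ∈ squares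
    sq∈squares {x} x≢0 with in-weight-Bit x
    ... | inj₁ w≡0 = ∈-map⁺ sq (∈-entered-by⁺ x≢0 w≡0)
    ... | inj₂ w≡1 = subst (_∈ squares) (sq-neg x) (∈-map⁺ sq (∈-entered-by⁺ (-‿≢0 x≢0) (in-weight-neg-0 x≢0 w≡1)))

    imageSize≡length-entered-by-0 :
      ∀ (h : Carrier → Carrier) {k} → Bit k → h 0# ≡ 0# → (∀ a → φ⁻¹ (h a) ≢ 0#) →
      (∀ x → out-weight x ≡ k → ∃[ a ] h a ≡ φ x) →
      imageSize (λ a → sq (φ⁻¹ (h a))) ≡ length (entered-by 0)
    imageSize≡length-entered-by-0 h {k} bit-k h0≡0 h≢0 out-weight-k-reached =
      trans (imageSize≡length g squares-unique (λ a → sq∈squares (h≢0 a)) onto) (length-map sq (entered-by 0))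
      where
      g : Carrier → Carrier
      g a = sq (φ⁻¹ (h a))
      reached : ∀ x → φ x ≡ 0# ⊎ out-weight x ≡ k → ∃[ a ] g a ≡ sq x
      reached x (inj₁ φx≡0) = 0# , cong sq (trans (cong φ⁻¹ (trans h0≡0 (sym φx≡0))) (φ⁻¹∘φ x))
      reached x (inj₂ w≡k) with a , ha≡φx ← out-weight-k-reached x w≡k = a , cong sq (trans (cong φ⁻¹ ha≡φx) (φ⁻¹∘φ x))
      y-or-−y-reached : ∀ {y} → y ≢ 0# → (φ y ≡ 0# ⊎ out-weight y ≡ k) ⊎ (φ (- y) ≡ 0# ⊎ out-weight (- y) ≡ k)
      y-or-−y-reached {y} y≢0 with φ y ≟ 0# | φ (- y) ≟ 0#
      ... | yes φy≡0 | _          = inj₁ (inj₁ φy≡0)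
      ... | no  _    | yes φ-y≡0  = inj₂ (inj₁ φ-y≡0)
      ... | no  φy≢0 | no  φ-y≢0  =
        Sum.map inj₂ inj₂ (Bit-≢-cover (out-weight-Bit y) (out-weight-Bit (- y)) bit-k (out-weight-neg y≢0 φy≢0 φ-y≢0))
      onto : ∀ {z} → z ∈ squares → ∃[ a ] g a ≡ z
      onto z∈ with y , y∈ , refl ← ∈-map⁻ sq z∈ with y≢0 , _ ← ∈-entered-by⁻ y∈ =
        [ reached y , (λ reason → Prod.map₂ (λ ga≡ → trans ga≡ (sq-neg y)) (reached (- y) reason)) ] (y-or-−y-reached y≢0)

    some-imageSize≡half : imageSize (λ a → sq (φ⁻¹ (sq a))) ≡ (size ∸ 1) / 2 ⊎ imageSize (λ a → sq (φ⁻¹ (λ' * sq a))) ≡ (size ∸ 1) / 2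
    some-imageSize≡half with weight-Bit 0# v₁
    ... | inj₁ w≡0 = inj₂ (trans (imageSize≡length-entered-by-0 (λ a → λ' * sq a) (inj₂ refl) λ'00≡0 φ⁻¹-λaa≢0 reached)
                            length-entered-by-0)
      where
      λ'00≡0 : λ' * sq 0# ≡ 0#
      λ'00≡0 = trans (cong (λ' *_) (zeroˡ 0#)) (zeroʳ λ')
      φ⁻¹-λaa≢0 : ∀ a → φ⁻¹ (λ' * sq a) ≢ 0#
      φ⁻¹-λaa≢0 a φ⁻¹≡0 with λ'aa≡v₁v₁ ← trans (sym (φ∘φ⁻¹ _)) (trans (cong φ φ⁻¹≡0) (sym (weight≡0⇒ w≡0))) | a ≟ 0#
      ... | yes refl = v₁≢0 (sq≡0⇒≡0 v₁ (trans (sym λ'aa≡v₁v₁) λ'00≡0))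
      ... | no  a≢0  = nonsquare*sq≢sq λ'-nonsquare a≢0 λ'aa≡v₁v₁
      reached : ∀ x → out-weight x ≡ 1 → ∃[ a ] λ' * sq a ≡ φ x
      reached x w≡1 = next x , Edge-weight≡1⇒ (Edge-next x) w≡1
    ... | inj₂ w≡1 = inj₁ (trans (imageSize≡length-entered-by-0 sq (inj₁ refl) (zeroˡ 0#) φ⁻¹-aa≢0 reached)
                            length-entered-by-0)
      where
      φ⁻¹-aa≢0 : ∀ a → φ⁻¹ (sq a) ≢ 0#
      φ⁻¹-aa≢0 a φ⁻¹≡0 = nonsquare*sq≢sq λ'-nonsquare v₁≢0
        (trans (Edge-weight≡1⇒ (Edge-next 0#) w≡1) (trans (cong φ (sym φ⁻¹≡0)) (φ∘φ⁻¹ (sq a))))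
      reached : ∀ x → out-weight x ≡ 0 → ∃[ a ] sq a ≡ φ x
      reached x w≡0 = next x , weight≡0⇒ w≡0

theorem2p8 : ∀ {c : Level} (F : FiniteField c) → let open FiniteField F in
    (∃[ p ] ∃[ k ] (Prime p × p ≢ 2 × 0 < k × size ≡ p ^ k)) →
    (λ' : Carrier) → ¬ IsSquare λ' →
    (f : Poly) (finv : Carrier → Carrier) →
    (∀ x → finv (eval f x) ≡ x) → (∀ y → eval f (finv y) ≡ y) →
    Graph.Connected F λ' (eval f) →
    imageSize (λ a → sq (finv (sq a))) ≢ (size ∸ 1) / 2 →
    imageSize (λ a → sq (finv (λ' * sq a))) ≢ (size ∸ 1) / 2 →
    ¬ (∃[ H ] (Graph.HamiltonianCycle F λ' (eval f) H × Graph.CycleType F λ' (eval f) 1 H))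
theorem2p8 F _ λ' λ'-nonsquare f finv finv∘f f∘finv _ size₁≢ size₂≢
           (_ , (H-unique , H-complete , H-cycle) , xs , ys , refl , _ , no-longer-trail) =
  [ size₁≢ , size₂≢ ] (HamiltonianCycleOfType1.some-imageSize≡half F λ' λ'-nonsquare (eval f) finv finv∘f f∘finv
    (ys ++ xs)
    (Permutation.Unique-resp-↭ (setoid _) (↭⇒↭ₛ rotation) H-unique)
    (λ z → ∈-resp-↭ rotation (H-complete z))
    (CyclicWalk-rotate xs 0# ys H-cycle)
    (¬HasTrail2⇒Alternating (ys ++ xs) (no-longer-trail 2 (s≤s (s≤s ℕ.z≤n)))))
  where
  open FiniteField F
  open GraphProperties F λ' (eval f)
  rotation : xs ++ 0# ∷ ys ↭ 0# ∷ ys ++ xs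
  rotation = ↭-++-comm xs (0# ∷ ys)
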